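{- Every infinite word belonging to $\mathbf{P}$ belongs to $\mathcal{P}_\infty$; that is, $\mathbf{P}\subseteq \mathcal{P}_\infty$.
   Context: All alphabets are finite. For an infinite word $x$ over an alphabet $\mathbb{A}$, a prefixal factorization of $x$ is a factorization $x=V_0V_1V_2\cdots$ in which every $V_i$ is a non-empty prefix of $x$. A finite non-empty word $u$ is bordered if some non-empty word $v\neq u$ is both a prefix and a suffix of $u$, and unbordered otherwise; $UP(x)$ denotes the set of non-empty unbordered prefixes of $x$. $\mathcal{P}_1$ is the set of infinite words (over any finite alphabet) admitting a prefixal factorization. Every $x\in\mathcal{P}_1$ has a unique factorization $x=U_0U_1U_2\cdots$ with all $U_i\in UP(x)$; let $UP'(x)=\{U_i: i\ge 0\}$, $n_x=\mathrm{card}(UP'(x))$, order $UP'(x)$ by the index of first occurrence in this factorization, let $\phi:\{1,\dots,n_x\}\to UP'(x)$ be the order-preserving bijection, and define the derived word $\delta(x)=\phi^{ -1}(U_0)\phi^{ -1}(U_1)\phi^{ -1}(U_2)\cdots\in\{1,\dots,n_x\}^\omega$. Define recursively $\mathcal{P}_{n+1}=\{x\in\mathcal{P}_n:\delta(x)\in\mathcal{P}_n\}$ and $\mathcal{P}_\infty=\bigcap_{n\ge1}\mathcal{P}_n$ (equivalently, $x\in\mathcal{P}_\infty$ iff $x\in\mathcal{P}_1$ and $\delta^n(x)\in\mathcal{P}_1$ for all $n\ge1$). For a coloring $\varphi:\mathbb{A}^+\to C$, a factorization $x=V_0V_1V_2\cdots$ into non-empty words is $\varphi$-monochromatic if $\varphi(V_i)$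 is the same for all $i\ge0$. $\mathbf{P}$ is the class of infinite words $x$ over a finite alphabet $\mathbb{A}$ such that for every coloring $\varphi:\mathbb{A}^+\to C$ with $C$ finite, $x$ admits a $\varphi$-monochromatic factorization. -}

module Defs where

open import Data.Nat using (ℕ; zero; suc; _+_; _∸_; _<_)
open import Data.Fin using (Fin)
open import Data.List using (List; []; _∷_; _++_; map; upTo; length)
open import Data.List.NonEmpty using (List⁺; _∷_)
open import Data.List.Membership.Propositional using (_∈_)
open import Data.List.Properties using (≡-dec)
open import Data.Product using (Σ; ∃; _×_; _,_)
open import Relation.Binary.PropositionalEquality using (_≡_; _≢_)
open import Relation.Binary.Definitions using (DecidableEquality)
open import Relation.Nullary using (¬_; yes; no)

Word : Set → Set
Word A = ℕ → A

segment : {A : Set} → Word A → ℕ → ℕ → List A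
segment x a len = map (λ j → x (a + j)) (upTo len)

pref : {A : Set} → Word A → ℕ → List A
pref x n = segment x 0 n

-- A factorization x = V₀V₁V₂⋯ into non-empty words, given by cut
-- positions c with c 0 = 0 and c strictly increasing; V_i = x[c i .. c (i+1) - 1].
IsFactorization : (ℕ → ℕ) → Set
IsFactorization c = (c 0 ≡ 0) × (∀ i → c i < c (suc i))

block : {A : Set} → Word A → (ℕ → ℕ) → ℕ → List A
block x c i = segment x (c i) (c (suc i) ∸ c i)

block⁺ : {A : Set} → Word A → (ℕ → ℕ) → ℕ → List⁺ A
block⁺ x c i = x (c i) ∷ segment x (suc (c i)) (c (suc i) ∸ suc (c i))

IsNonEmptyPrefix : {A : Set} → Word A → List A → Set
IsNonEmptyPrefix x u = (u ≢ []) × (u ≡ pref x (length u))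

IsPrefixOf : {A : Set} → List A → List A → Set
IsPrefixOf v u = ∃ λ w → v ++ w ≡ u

IsSuffixOf : {A : Set} → List A → List A → Set
IsSuffixOf v u = ∃ λ w → w ++ v ≡ u

Bordered : {A : Set} → List A → Set
Bordered u = ∃ λ v → (v ≢ []) × (v ≢ u) × IsPrefixOf v u × IsSuffixOf v u

Unbordered : {A : Set} → List A → Set
Unbordered u = ¬ Bordered u

FiniteAlphabet : {A : Set} → Word A → Set
FiniteAlphabet {A} x = Σ (List A) λ L → ∀ i → x i ∈ L

IsPrefixalFactorization : {A : Set} → Word A → (ℕ → ℕ) → Set
IsPrefixalFactorization x c =
  IsFactorization c × (∀ i → IsNonEmptyPrefix x (block x c i))

P₁ : {A : Set} → Word A → Set
P₁ x = FiniteAlphabet x × (∃ λ c → IsPrefixalFactorization x c)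

IsUPFactorization : {A : Set} → Word A → (ℕ → ℕ) → Set
IsUPFactorization x c =
  IsFactorization c
  × (∀ i → IsNonEmptyPrefix x (block x c i) × Unbordered (block x c i))

-- Index (0-based) of the first occurrence of an element in a list
-- (returns the length of the list if absent).
indexOf : {B : Set} → DecidableEquality B → B → List B → ℕ
indexOf _≟_ b [] = 0
indexOf _≟_ b (a ∷ as) with b ≟ a
... | yes _ = 0
... | no  _ = suc (indexOf _≟_ b as)

addNew : {B : Set} → DecidableEquality B → B → List B → List B
addNew _≟_ b [] = b ∷ []
addNew _≟_ b (a ∷ as) with b ≟ a
... | yes _ = a ∷ as
... | no  _ = a ∷ addNew _≟_ b as

module _ {A : Set} (_≟_ : DecidableEquality A) (x : Word A) (c : ℕ → ℕ) where

  private
    _≟L_ : DecidableEquality (List A)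
    _≟L_ = ≡-dec _≟_

  distinctFactors : ℕ → List (List A)
  distinctFactors zero = []
  distinctFactors (suc i) = addNew _≟L_ (block x c i) (distinctFactors i)

  -- φ⁻¹(U_i) ∈ {1,…,n_x}: 1 + position of U_i in the first-occurrence order.
  derivedLetter : ℕ → ℕ
  derivedLetter i = suc (indexOf _≟L_ (block x c i) (distinctFactors (suc i)))

-- y = δ(x): y is the derived word of x w.r.t. its factorization into
-- unbordered prefixes (that factorization is unique for x ∈ 𝒫₁).
IsDerived : {A : Set} → DecidableEquality A → Word A → Word ℕ → Set
IsDerived _≟_ x y =
  ∃ λ c → IsUPFactorization x c × (∀ i → y i ≡ derivedLetter _≟_ x c i)

_≟ℕ_ : DecidableEquality ℕ
_≟ℕ_ = Data.Nat._≟_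

-- IsDerivedIter n x y : y = δ^(n+1)(x).
IsDerivedIter : {A : Set} → DecidableEquality A → ℕ → Word A → Word ℕ → Set
IsDerivedIter _≟_ zero x y = IsDerived _≟_ x y
IsDerivedIter _≟_ (suc n) x z =
  ∃ λ y → IsDerivedIter _≟_ n x y × IsDerived _≟ℕ_ y z

P∞ : {A : Set} → DecidableEquality A → Word A → Set
P∞ _≟_ x =
  P₁ x
  × (∀ n → (∃ λ y → IsDerivedIter _≟_ n x y × P₁ y)
           × (∀ y → IsDerivedIter _≟_ n x y → P₁ y))

IsMonochromatic : {A C : Set} → (List⁺ A → C) → Word A → (ℕ → ℕ) → Set
IsMonochromatic φ x c =
  IsFactorization c × (∀ i → φ (block⁺ x c i) ≡ φ (block⁺ x c 0))

BigP : {k : ℕ} → Word (Fin k) → Set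
BigP {k} x = ∀ (m : ℕ) (φ : List⁺ (Fin k) → Fin m) →
  ∃ λ c → IsMonochromatic φ x c

module Submission where

-- Colouring a word by "is a prefix of x" shows that the first, hence every, block of a monochromatic
-- factorization of x is a prefix of x.  A prefix with a border of length b splits into a shorter prefix
-- followed by an occurrence of the prefix of length b, so every prefix is a product of unbordered
-- prefixes; refining the blocks gives a factorization of x into unbordered prefixes.  It is unique, since
-- an occurrence of an unbordered prefix cannot properly overlap the start of an occurrence of a prefix
-- that extends beyond it.
--
-- For δ(x) ∈ 𝐏, take a colouring ψ of factors of δ(x).  Colour a factor w of x by the prefix bit together
-- with, for every candidate table T (a list of lengths of distinct unbordered prefixes), ψ of the letters
-- that T assigns to the unbordered pieces of w.  There are finitely many tables: the factors of x have
-- length at most |U₀| and distinct ones have distinct lengths.  In a monochromatic factorization the pieces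
-- are, by uniqueness, the factors Uᵢ of x, and the table of first occurrences up to a late enough factor
-- computes the corresponding blocks of δ(x); so those blocks are ψ-monochromatic.

open import Defs
open import Data.Nat using (ℕ)
open import Data.Fin using (Fin)
open import Data.Fin.Properties using (_≟_)

open import Data.Nat using (zero; suc; _+_; _∸_; _^_; _<_; _≤_; z≤n; s≤s; _<?_)
open import Data.Nat.Properties hiding (_≟_)
open import Data.Nat.Induction using (<-rec)
open import Data.Nat.ListAction using (sum)
open import Data.Fin using (zero; suc)
import Data.Fin as Fin
import Data.Fin.Properties as Fin
open import Data.List using (List; []; _∷_; _++_; map; upTo; applyUpTo; length; take; lookup; concatMap; allFin)
open import Data.List.Properties
  using (≡-dec; map-upTo; length-++; length-map; ∷-injectiveˡ; ∷-injectiveʳ; take-all; map-∘; map-id-local)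
open import Data.List.NonEmpty using (List⁺; _∷_; toList)
open import Data.List.Membership.Propositional using (_∈_)
open import Data.List.Membership.Propositional.Properties using (∈-lookup; ∈-map⁺; ∈-concatMap⁺; ∈-upTo⁺; ∈-allFin)
open import Data.List.Relation.Unary.Any as Any using (here; there)
open import Data.List.Relation.Unary.All as All using (All; []; _∷_)
open import Data.List.Relation.Unary.All.Properties using (map⁺)
open import Data.List.Relation.Unary.AllPairs using ([]; _∷_)
open import Data.List.Relation.Unary.Unique.Propositional using (Unique)
open import Data.List.Relation.Unary.Unique.Propositional.Properties using (map⁻)
open import Data.Product using (∃; _×_; _,_; proj₁; proj₂)
open import Data.Sum using (_⊎_; inj₁; inj₂)
open import Data.Empty using (⊥; ⊥-elim)
open import Function using (_∘_)
open import Relation.Binary.PropositionalEquality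
  using (_≡_; _≢_; refl; sym; trans; cong; cong₂; subst; subst₂; module ≡-Reasoning)
open import Relation.Binary.Definitions using (DecidableEquality; tri<; tri≈; tri>)
open import Relation.Nullary using (¬_; Dec; yes; no)
open import Relation.Nullary.Decidable using (map′; _×-dec_)

seg : {A : Set} → Word A → ℕ → ℕ → List A
seg x a zero    = []
seg x a (suc n) = x a ∷ seg x (suc a) n

module _ {A : Set} (x : Word A) where

  applyUpTo≡seg : (f : ℕ → A) (a : ℕ) → (∀ j → f j ≡ x (a + j)) →
                  ∀ n → applyUpTo f n ≡ seg x a n
  applyUpTo≡seg f a f≗ zero    = refl
  applyUpTo≡seg f a f≗ (suc n) =
    cong₂ _∷_ (trans (f≗ 0) (cong x (+-identityʳ a)))
              (applyUpTo≡seg (f ∘ suc) (suc a) (λ j → trans (f≗ (suc j)) (cong x (+-suc a j))) n)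

  segment≡seg : ∀ a n → segment x a n ≡ seg x a n
  segment≡seg a n = trans (map-upTo (λ j → x (a + j)) n) (applyUpTo≡seg _ a (λ _ → refl) n)

  pref≡seg : ∀ n → pref x n ≡ seg x 0 n
  pref≡seg = segment≡seg 0

  length-seg : ∀ a n → length (seg x a n) ≡ n
  length-seg a zero    = refl
  length-seg a (suc n) = cong suc (length-seg (suc a) n)

  seg-++ : ∀ a m n → seg x a (m + n) ≡ seg x a m ++ seg x (a + m) n
  seg-++ a zero    n = cong (λ b → seg x b n) (sym (+-identityʳ a))
  seg-++ a (suc m) n =
    cong (x a ∷_) (trans (seg-++ (suc a) m n) (cong (λ b → seg x (suc a) m ++ seg x b n) (sym (+-suc a m))))

  ++-≡-seg : ∀ (us vs : List A) a n → us ++ vs ≡ seg x a n →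
             us ≡ seg x a (length us) × vs ≡ seg x (a + length us) (length vs)
  ++-≡-seg []       vs a n eq =
    refl , trans eq (cong₂ (seg x) (sym (+-identityʳ a)) (sym (trans (cong length eq) (length-seg a n))))
  ++-≡-seg (u ∷ us) vs a (suc n) eq with ++-≡-seg us vs (suc a) n (∷-injectiveʳ eq)
  ... | us≡ , vs≡ =
    cong₂ _∷_ (∷-injectiveˡ eq) us≡ , trans vs≡ (cong (λ b → seg x b (length vs)) (sym (+-suc a (length us))))

  seg-≡⁺ : ∀ a b n → (∀ j → j < n → x (a + j) ≡ x (b + j)) → seg x a n ≡ seg x b n
  seg-≡⁺ a b zero    _  = refl
  seg-≡⁺ a b (suc n) eq =
    cong₂ _∷_ (trans (cong x (sym (+-identityʳ a))) (trans (eq 0 (s≤s z≤n)) (cong x (+-identityʳ b))))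
              (seg-≡⁺ (suc a) (suc b) n λ j j<n →
                trans (cong x (sym (+-suc a j))) (trans (eq (suc j) (s≤s j<n)) (cong x (+-suc b j))))

  seg-≡⁻ : ∀ a b n → seg x a n ≡ seg x b n → ∀ j → j < n → x (a + j) ≡ x (b + j)
  seg-≡⁻ a b (suc n) eq zero    _ =
    trans (cong x (+-identityʳ a)) (trans (∷-injectiveˡ eq) (cong x (sym (+-identityʳ b))))
  seg-≡⁻ a b (suc n) eq (suc j) (s≤s j<n) =
    trans (cong x (+-suc a j))
          (trans (seg-≡⁻ (suc a) (suc b) n (∷-injectiveʳ eq) j j<n) (cong x (sym (+-suc b j))))

module _ {c : ℕ → ℕ} (c-inc : ∀ i → c i < c (suc i)) where

  strictMono⇒mono : ∀ {k m} → k ≤ m → c k ≤ c m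
  strictMono⇒mono {k} {m} k≤m with m≤n⇒m<n∨m≡n k≤m
  ... | inj₂ refl = ≤-refl
  strictMono⇒mono {k} {suc m} _ | inj₁ (s≤s k≤m) = ≤-trans (strictMono⇒mono k≤m) (<⇒≤ (c-inc m))

  strictMono : ∀ {k m} → k < m → c k < c m
  strictMono {k} {suc m} (s≤s k≤m) = ≤-<-trans (strictMono⇒mono k≤m) (c-inc m)

  locate : ∀ k t → c k < t → ∃ λ m → k ≤ m × c m < t × t ≤ c (suc m)
  locate k t ck<t = go t k ck<t (m≤m+n t (c k))
    where
    go : ∀ f k → c k < t → t ≤ f + c k → ∃ λ m → k ≤ m × c m < t × t ≤ c (suc m)
    go zero    k ck<t t≤ck = ⊥-elim (<⇒≱ ck<t t≤ck)
    go (suc f) k ck<t t≤ with t ≤? c (suc k)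
    ... | yes t≤csk = k , ≤-refl , ck<t , t≤csk
    ... | no  t≰csk with go f (suc k) (≰⇒> t≰csk)
                          (≤-trans t≤ (≤-trans (≤-reflexive (sym (+-suc f (c k)))) (+-monoʳ-≤ f (c-inc k))))
    ...   | m , sk≤m , cm<t , t≤csm = m , ≤-trans (n≤1+n k) sk≤m , cm<t , t≤csm

nth : List ℕ → ℕ → ℕ
nth []       _       = 0
nth (l ∷ _)  zero    = l
nth (_ ∷ ls) (suc j) = nth ls j

sum-take-suc : ∀ ls j → j < length ls → sum (take (suc j) ls) ≡ sum (take j ls) + nth ls j
sum-take-suc (l ∷ ls) zero    _         = +-identityʳ l
sum-take-suc (l ∷ ls) (suc j) (s≤s j<) = trans (cong (l +_) (sum-take-suc ls j j<)) (sym (+-assoc l _ _))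

seg≡map : {A : Set} (x : Word A) (g : ℕ → A) → ∀ k ls → (∀ j → j < length ls → x (k + j) ≡ g (nth ls j)) →
          seg x k (length ls) ≡ map g ls
seg≡map x g k []       _   = refl
seg≡map x g k (l ∷ ls) x≗ =
  cong₂ _∷_ (trans (cong x (sym (+-identityʳ k))) (x≗ 0 (s≤s z≤n)))
            (seg≡map x g (suc k) ls λ j j< → trans (cong x (sym (+-suc k j))) (x≗ (suc j) (s≤s j<)))

module Occurrences {A : Set} (x : Word A) where

  PrefixAt : ℕ → ℕ → Set
  PrefixAt p n = ∀ j → j < n → x (p + j) ≡ x j

  PrefixAt⇒seg : ∀ {p n} → PrefixAt p n → seg x p n ≡ seg x 0 n
  PrefixAt⇒seg {p} {n} = seg-≡⁺ x p 0 n

  seg⇒PrefixAt : ∀ {p n} → seg x p n ≡ seg x 0 n → PrefixAt p n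
  seg⇒PrefixAt {p} {n} = seg-≡⁻ x p 0 n

  -- A border of length b of the prefix of length r + b is an occurrence PrefixAt r b.
  UnborderedPrefix : ℕ → Set
  UnborderedPrefix ℓ = 0 < ℓ × (∀ r b → r + b ≡ ℓ → 0 < r → 0 < b → ¬ PrefixAt r b)

  UnborderedPrefixAt : ℕ → ℕ → Set
  UnborderedPrefixAt p ℓ = PrefixAt p ℓ × UnborderedPrefix ℓ

  PrefixalFactorization : (ℕ → ℕ) → Set
  PrefixalFactorization c = IsFactorization c × (∀ i → PrefixAt (c i) (c (suc i) ∸ c i))

  UPFactorization : (ℕ → ℕ) → Set
  UPFactorization c = IsFactorization c × (∀ i → UnborderedPrefixAt (c i) (c (suc i) ∸ c i))

  -- The overlap x[a, e) is a suffix of the unbordered prefix occurring at s and a prefix of x.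
  unbordered-overlap : ∀ {s e a f} → UnborderedPrefixAt s (e ∸ s) → s < a → a < e → e ≤ f →
                       PrefixAt a (f ∸ a) → ⊥
  unbordered-overlap {s} {e} {a} {f} (occ , _ , unbordered) s<a a<e e≤f occ′ =
    unbordered r b r+b≡ (m<n⇒0<n∸m s<a) (m<n⇒0<n∸m a<e) border
    where
    r = a ∸ s
    b = e ∸ a
    s+r≡a : s + r ≡ a
    s+r≡a = m+[n∸m]≡n (<⇒≤ s<a)
    s+[r+b]≡e : s + (r + b) ≡ e
    s+[r+b]≡e = trans (sym (+-assoc s r b)) (trans (cong (_+ b) s+r≡a) (m+[n∸m]≡n (<⇒≤ a<e)))
    r+b≡ : r + b ≡ e ∸ s
    r+b≡ = trans (sym (m+n∸m≡n s (r + b))) (cong (_∸ s) s+[r+b]≡e)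
    border : PrefixAt r b
    border j j<b =
      trans (sym (occ (r + j) (subst (r + j <_) r+b≡ (+-monoʳ-< r j<b))))
            (trans (cong x (trans (sym (+-assoc s r j)) (cong (_+ j) s+r≡a)))
                   (occ′ j (<-≤-trans j<b (∸-monoˡ-≤ a e≤f))))

  Chain : ℕ → List ℕ → ℕ → Set
  Chain p []       q = p ≡ q
  Chain p (l ∷ ls) q = UnborderedPrefixAt p l × Chain (p + l) ls q

  Chain-sum : ∀ {p} ls {q} → Chain p ls q → p + sum ls ≡ q
  Chain-sum {p} []       p≡q          = trans (+-identityʳ p) p≡q
  Chain-sum {p} (l ∷ ls) (_ , chain) = trans (sym (+-assoc p l (sum ls))) (Chain-sum ls chain)

  Chain-nth : ∀ {p} ls {q} → Chain p ls q → ∀ j → j < length ls →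
              UnborderedPrefixAt (p + sum (take j ls)) (nth ls j)
  Chain-nth {p} (l ∷ ls) (u , _)     zero    _         =
    subst (λ z → UnborderedPrefixAt z l) (sym (+-identityʳ p)) u
  Chain-nth {p} (l ∷ ls) (_ , chain) (suc j) (s≤s j<) =
    subst (λ z → UnborderedPrefixAt z (nth ls j)) (+-assoc p l _) (Chain-nth ls chain j j<)

  Chain-++ : ∀ {p} ls {q ms s} → Chain p ls q → Chain q ms s → Chain p (ls ++ ms) s
  Chain-++ []       refl         chain′ = chain′
  Chain-++ (l ∷ ls) (u , chain) chain′ = u , Chain-++ ls chain chain′

  Chain-shift : ∀ {D L p} ls {q} → PrefixAt D L → q ≤ L → Chain p ls q → Chain (D + p) ls (D + q)
  Chain-shift []       _   _   refl = refl
  Chain-shift {D} {L} {p} (l ∷ ls) {q} occ q≤L ((occₗ , u) , chain) =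
    (occ′ , u) , subst (λ z → Chain z ls (D + q)) (sym (+-assoc D p l)) (Chain-shift ls occ q≤L chain)
    where
    p+l≤q : p + l ≤ q
    p+l≤q = ≤-trans (+-monoʳ-≤ p (m≤m+n l (sum ls))) (≤-reflexive (Chain-sum (l ∷ ls) ((occₗ , u) , chain)))
    occ′ : PrefixAt (D + p) l
    occ′ j j<l = trans (cong x (+-assoc D p j))
                       (trans (occ (p + j) (<-≤-trans (+-monoʳ-< p j<l) (≤-trans p+l≤q q≤L))) (occₗ j j<l))

  unbordered≤first-cut : ∀ (c : ℕ → ℕ) {v} → PrefixalFactorization c → UnborderedPrefix v → v ≤ c 1
  unbordered≤first-cut c {v} ((c0≡0 , c-inc) , occ) u with v ≤? c 1
  ... | yes v≤c1 = v≤c1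
  ... | no  v≰c1 with locate c-inc 1 v (≰⇒> v≰c1)
  ...   | m , 1≤m , cm<v , v≤csm =
          ⊥-elim (unbordered-overlap ((λ _ _ → refl) , u) 0<cm cm<v v≤csm (occ m))
    where
    0<cm : 0 < c m
    0<cm = subst (_< c m) c0≡0 (strictMono c-inc 1≤m)

  UP⇒Prefixal : ∀ (c : ℕ → ℕ) → UPFactorization c → PrefixalFactorization c
  UP⇒Prefixal c (fact , u) = fact , λ i → proj₁ (u i)

  cut-cannot-overshoot : ∀ (c c′ : ℕ → ℕ) n → PrefixalFactorization c →
                         UnborderedPrefixAt (c′ n) (c′ (suc n) ∸ c′ n) →
                         c n ≡ c′ n → ¬ c (suc n) < c′ (suc n)
  cut-cannot-overshoot c c′ n ((_ , c-inc) , occ) u cn≡c′n overshoot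
    with locate c-inc (suc n) (c′ (suc n)) overshoot
  ... | m , sn≤m , cm< , ≤csm = unbordered-overlap u c′n<cm cm< ≤csm (occ m)
    where
    c′n<cm : c′ n < c m
    c′n<cm = subst (_< c m) cn≡c′n (<-≤-trans (c-inc n) (strictMono⇒mono c-inc sn≤m))

  UPFactorization-unique : ∀ (c c′ : ℕ → ℕ) → UPFactorization c → UPFactorization c′ → ∀ n → c n ≡ c′ n
  UPFactorization-unique c c′ ((c0≡0 , _) , _) ((c′0≡0 , _) , _) zero = trans c0≡0 (sym c′0≡0)
  UPFactorization-unique c c′ U U′ (suc n)
    with UPFactorization-unique c c′ U U′ n | <-cmp (c (suc n)) (c′ (suc n))
  ... | _    | tri≈ _ eq _ = eq
  ... | cn≡ | tri< lt _ _ = ⊥-elim (cut-cannot-overshoot c c′ n (UP⇒Prefixal c U) (proj₂ U′ n) cn≡ lt)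
  ... | cn≡ | tri> _ _ gt = ⊥-elim (cut-cannot-overshoot c′ c n (UP⇒Prefixal c′ U′) (proj₂ U n) (sym cn≡) gt)

module Decomposition {A : Set} (_≟A_ : DecidableEquality A) (x : Word A) where
  open Occurrences x

  PrefixAt? : ∀ p n → Dec (PrefixAt p n)
  PrefixAt? p n = map′ seg⇒PrefixAt PrefixAt⇒seg (≡-dec _≟A_ (seg x p n) (seg x 0 n))

  unbordered-or-border : ∀ ℓ → 0 < ℓ → UnborderedPrefix ℓ ⊎ ∃ λ r → 0 < r × r < ℓ × PrefixAt r (ℓ ∸ r)
  unbordered-or-border ℓ 0<ℓ
    with Fin.any? (λ (r : Fin ℓ) → (0 <? Fin.toℕ r) ×-dec PrefixAt? (Fin.toℕ r) (ℓ ∸ Fin.toℕ r))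
  ... | yes (r , border) = inj₂ (Fin.toℕ r , proj₁ border , Fin.toℕ<n r , proj₂ border)
  ... | no  no-border    = inj₁ (0<ℓ , λ r b r+b≡ℓ 0<r 0<b occ → no-border (witness r b r+b≡ℓ 0<r 0<b occ))
    where
    witness : ∀ r b → r + b ≡ ℓ → 0 < r → 0 < b → PrefixAt r b →
              ∃ λ (r′ : Fin ℓ) → 0 < Fin.toℕ r′ × PrefixAt (Fin.toℕ r′) (ℓ ∸ Fin.toℕ r′)
    witness r b r+b≡ℓ 0<r 0<b occ =
      Fin.fromℕ< r<ℓ ,
      subst (λ r′ → 0 < r′ × PrefixAt r′ (ℓ ∸ r′)) (sym (Fin.toℕ-fromℕ< r<ℓ))
            (0<r , subst (PrefixAt r) (trans (sym (m+n∸m≡n r b)) (cong (_∸ r) r+b≡ℓ)) occ)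
      where
      r<ℓ : r < ℓ
      r<ℓ = subst (r <_) r+b≡ℓ (m<m+n r 0<b)

  prefix-decomposition : ∀ ℓ → ∃ λ ls → Chain 0 ls ℓ
  prefix-decomposition = <-rec _ decompose
    where
    decompose : ∀ ℓ → (∀ {m} → m < ℓ → ∃ λ ls → Chain 0 ls m) → ∃ λ ls → Chain 0 ls ℓ
    decompose zero      _   = [] , refl
    decompose ℓ@(suc _) rec with unbordered-or-border ℓ (s≤s z≤n)
    ... | inj₁ u = ℓ ∷ [] , ((λ _ _ → refl) , u) , refl
    ... | inj₂ (r , 0<r , r<ℓ , occ) with rec r<ℓ | rec (∸-monoʳ-< {ℓ} 0<r (<⇒≤ r<ℓ))
    ...   | ls , chain | ms , chain′ = ls ++ ms , Chain-++ ls chain chain″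
      where
      chain″ : Chain r ms ℓ
      chain″ = subst₂ (λ p q → Chain p ms q) (+-identityʳ r) (m+[n∸m]≡n (<⇒≤ r<ℓ))
                      (Chain-shift ms occ ≤-refl chain′)

  decomposition : ℕ → List ℕ
  decomposition ℓ = proj₁ (prefix-decomposition ℓ)

  decomposition-chain : ∀ ℓ → Chain 0 (decomposition ℓ) ℓ
  decomposition-chain ℓ = proj₂ (prefix-decomposition ℓ)

module Glue {A : Set} (x : Word A) (d : ℕ → ℕ) (d-fact : IsFactorization d) (ls : ℕ → List ℕ)
            (ls-nonempty : ∀ i → 0 < length (ls i))
            (ls-chain : ∀ i → Occurrences.Chain x (d i) (ls i) (d (suc i))) where
  open Occurrences x

  len : ℕ → ℕ
  len i = length (ls i)

  start : ℕ → ℕ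
  start zero    = 0
  start (suc i) = start i + len i

  start-factorization : IsFactorization start
  start-factorization = refl , λ i → m<m+n (start i) (ls-nonempty i)

  -- (i , j) stands for the j-th piece of the i-th block of d.
  next : ℕ × ℕ → ℕ × ℕ
  next (i , j) with suc j <? len i
  ... | yes _ = i , suc j
  ... | no  _ = suc i , 0

  next-cases : ∀ i j → j < len i → (next (i , j) ≡ (i , suc j) × suc j < len i)
                                   ⊎ (next (i , j) ≡ (suc i , 0) × suc j ≡ len i)
  next-cases i j j< with suc j <? len i
  ... | yes sj< = inj₁ (refl , sj<)
  ... | no  sj≮ with m≤n⇒m<n∨m≡n j<
  ...   | inj₁ sj< = ⊥-elim (sj≮ sj<)
  ...   | inj₂ sj≡ = inj₂ (refl , sj≡)

  position : ℕ → ℕ × ℕ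
  position zero    = 0 , 0
  position (suc n) = next (position n)

  position-valid : ∀ n → proj₂ (position n) < len (proj₁ (position n))
  position-valid zero = ls-nonempty 0
  position-valid (suc n) with next-cases (proj₁ (position n)) (proj₂ (position n)) (position-valid n)
  ... | inj₁ (eq , sj<) rewrite eq = sj<
  ... | inj₂ (eq , _)   rewrite eq = ls-nonempty _

  position-start : ∀ i j → j < len i → position (start i + j) ≡ (i , j)
  position-start zero    zero _ = refl
  position-start (suc i) zero _ =
    trans (cong position start≡) (trans (cong next (position-start i L L<)) next-last)
    where
    L = len i ∸ 1
    sL≡ : suc L ≡ len i
    sL≡ = trans (+-comm 1 L) (m∸n+n≡m (ls-nonempty i))
    L< : L < len i
    L< = ≤-reflexive sL≡
    start≡ : start (suc i) + 0 ≡ suc (start i + L)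
    start≡ = trans (+-identityʳ _) (trans (cong (start i +_) (sym sL≡)) (+-suc (start i) L))
    next-last : next (i , L) ≡ (suc i , 0)
    next-last with next-cases i L L<
    ... | inj₁ (_ , sL<) = ⊥-elim (<-irrefl sL≡ sL<)
    ... | inj₂ (eq , _)  = eq
  position-start i (suc j) sj< with next-cases i j (<-trans (n<1+n j) sj<)
  ... | inj₁ (eq , _) = trans (cong position (+-suc (start i) j))
                              (trans (cong next (position-start i j (<-trans (n<1+n j) sj<))) eq)
  ... | inj₂ (_ , sj≡) = ⊥-elim (<-irrefl sj≡ sj<)

  cutAt : ℕ × ℕ → ℕ
  cutAt (i , j) = d i + sum (take j (ls i))

  piece : ℕ × ℕ → ℕ
  piece (i , j) = nth (ls i) j

  cutAt-next : ∀ i j → j < len i → cutAt (next (i , j)) ≡ cutAt (i , j) + piece (i , j)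
  cutAt-next i j j< with next-cases i j j<
  ... | inj₁ (eq , _) rewrite eq =
        trans (cong (d i +_) (sum-take-suc (ls i) j j<)) (sym (+-assoc (d i) _ _))
  ... | inj₂ (eq , sj≡) rewrite eq = begin
        d (suc i) + 0                              ≡⟨ +-identityʳ _ ⟩
        d (suc i)                                  ≡⟨ Chain-sum (ls i) (ls-chain i) ⟨
        d i + sum (ls i)                           ≡⟨ cong (λ t → d i + sum t) (take-all (suc j) (ls i) (≤-reflexive (sym sj≡))) ⟨
        d i + sum (take (suc j) (ls i))            ≡⟨ cong (d i +_) (sum-take-suc (ls i) j j<) ⟩
        d i + (sum (take j (ls i)) + nth (ls i) j) ≡⟨ +-assoc (d i) _ _ ⟨
        d i + sum (take j (ls i)) + nth (ls i) j   ∎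
    where open ≡-Reasoning

  cut : ℕ → ℕ
  cut n = cutAt (position n)

  cut-step : ∀ n → cut (suc n) ≡ cut n + piece (position n)
  cut-step n = cutAt-next _ _ (position-valid n)

  cut-width : ∀ n → cut (suc n) ∸ cut n ≡ piece (position n)
  cut-width n = trans (cong (_∸ cut n) (cut-step n)) (m+n∸m≡n (cut n) _)

  piece-unbordered : ∀ n → UnborderedPrefixAt (cut n) (piece (position n))
  piece-unbordered n = Chain-nth (ls (proj₁ (position n))) (ls-chain _) _ (position-valid n)

  cut-UP : UPFactorization cut
  cut-UP = (trans (+-identityʳ (d 0)) (proj₁ d-fact) , cut-inc) ,
           λ n → subst (UnborderedPrefixAt (cut n)) (sym (cut-width n)) (piece-unbordered n)
    where
    cut-inc : ∀ n → cut n < cut (suc n)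
    cut-inc n = subst (cut n <_) (sym (cut-step n)) (m<m+n (cut n) (proj₁ (proj₂ (piece-unbordered n))))

  cut-width-start : ∀ i j → j < len i → cut (suc (start i + j)) ∸ cut (start i + j) ≡ nth (ls i) j
  cut-width-start i j j< = trans (cut-width (start i + j)) (cong piece (position-start i j j<))

module Refinement {A : Set} (_≟A_ : DecidableEquality A) (x : Word A) (d : ℕ → ℕ)
                  (d-prefixal : Occurrences.PrefixalFactorization x d) where
  open Occurrences x
  open Decomposition _≟A_ x

  width : ℕ → ℕ
  width i = d (suc i) ∸ d i

  pieces : ℕ → List ℕ
  pieces i = decomposition (width i)

  pieces-chain : ∀ i → Chain (d i) (pieces i) (d (suc i))
  pieces-chain i = subst₂ (λ p q → Chain p (pieces i) q)
                          (+-identityʳ (d i)) (m+[n∸m]≡n (<⇒≤ (proj₂ (proj₁ d-prefixal) i)))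
                          (Chain-shift (pieces i) (proj₂ d-prefixal i) ≤-refl (decomposition-chain (width i)))

  pieces-nonempty : ∀ i → 0 < length (pieces i)
  pieces-nonempty i with pieces i | decomposition-chain (width i)
  ... | []    | 0≡width = ⊥-elim (<-irrefl 0≡width (m<n⇒0<n∸m (proj₂ (proj₁ d-prefixal) i)))
  ... | _ ∷ _ | _       = s≤s z≤n

  open Glue x d (proj₁ d-prefixal) pieces pieces-nonempty pieces-chain public

module Correspondence {A : Set} (x : Word A) where
  open Occurrences x

  IsPrefix : List A → Set
  IsPrefix u = u ≡ pref x (length u)

  length>0 : {B : Set} {xs : List B} → xs ≢ [] → 0 < length xs
  length>0 {xs = []}    xs≢[] = ⊥-elim (xs≢[] refl)
  length>0 {xs = _ ∷ _} _     = s≤s z≤n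

  seg-nonempty : ∀ p {n} → 0 < n → seg x p n ≢ []
  seg-nonempty p {suc _} _ ()

  pref≡seg-length : ∀ p n → pref x (length (seg x p n)) ≡ seg x 0 n
  pref≡seg-length p n = trans (cong (pref x) (length-seg x p n)) (pref≡seg x n)

  seg-prefix⇒PrefixAt : ∀ {p n} → IsPrefix (seg x p n) → PrefixAt p n
  seg-prefix⇒PrefixAt {p} {n} eq = seg⇒PrefixAt (trans eq (pref≡seg-length p n))

  PrefixAt⇒seg-prefix : ∀ {p n} → PrefixAt p n → IsPrefix (seg x p n)
  PrefixAt⇒seg-prefix {p} {n} occ = trans (PrefixAt⇒seg occ) (sym (pref≡seg-length p n))

  Unbordered⇒UnborderedPrefix : ∀ {ℓ} → 0 < ℓ → Unbordered (seg x 0 ℓ) → UnborderedPrefix ℓ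
  Unbordered⇒UnborderedPrefix {ℓ} 0<ℓ unbordered = 0<ℓ , λ r b r+b≡ℓ 0<r 0<b occ →
    unbordered (seg x 0 b , seg-nonempty 0 0<b , shorter r+b≡ℓ 0<r ,
                (seg x b r , prefix {r} r+b≡ℓ) , (seg x 0 r , suffix r+b≡ℓ occ))
    where
    shorter : ∀ {r b} → r + b ≡ ℓ → 0 < r → seg x 0 b ≢ seg x 0 ℓ
    shorter {r} {b} r+b≡ℓ 0<r eq =
      <-irrefl (trans (sym (length-seg x 0 b)) (trans (cong length eq) (length-seg x 0 ℓ)))
               (subst (b <_) (trans (+-comm b r) r+b≡ℓ) (m<m+n b 0<r))
    prefix : ∀ {r b} → r + b ≡ ℓ → seg x 0 b ++ seg x b r ≡ seg x 0 ℓ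
    prefix {r} {b} r+b≡ℓ = trans (sym (seg-++ x 0 b r)) (cong (seg x 0) (trans (+-comm b r) r+b≡ℓ))
    suffix : ∀ {r b} → r + b ≡ ℓ → PrefixAt r b → seg x 0 r ++ seg x 0 b ≡ seg x 0 ℓ
    suffix {r} {b} r+b≡ℓ occ =
      trans (cong (seg x 0 r ++_) (sym (PrefixAt⇒seg occ))) (trans (sym (seg-++ x 0 r b)) (cong (seg x 0) r+b≡ℓ))

  UnborderedPrefix⇒Unbordered : ∀ {ℓ} → UnborderedPrefix ℓ → Unbordered (seg x 0 ℓ)
  UnborderedPrefix⇒Unbordered {ℓ} (_ , unbordered) (v , v≢[] , v≢u , (w , v++w≡u) , (w′ , w′++v≡u)) =
    unbordered (length w′) (length v) r+b≡ℓ (length>0 w′≢[]) (length>0 v≢[])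
               (seg⇒PrefixAt (trans (sym v-at-r) v-at-0))
    where
    v-at-0 : v ≡ seg x 0 (length v)
    v-at-0 = proj₁ (++-≡-seg x v w 0 ℓ v++w≡u)
    v-at-r : v ≡ seg x (length w′) (length v)
    v-at-r = proj₂ (++-≡-seg x w′ v 0 ℓ w′++v≡u)
    r+b≡ℓ : length w′ + length v ≡ ℓ
    r+b≡ℓ = trans (sym (length-++ w′)) (trans (cong length w′++v≡u) (length-seg x 0 ℓ))
    w′≢[] : w′ ≢ []
    w′≢[] refl = v≢u w′++v≡u

  block≡seg : ∀ c i → block x c i ≡ seg x (c i) (c (suc i) ∸ c i)
  block≡seg c i = segment≡seg x (c i) _

  block⁺≡seg : ∀ c i → c i < c (suc i) → toList (block⁺ x c i) ≡ seg x (c i) (c (suc i) ∸ c i)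
  block⁺≡seg c i ci<csi =
    trans (cong (x (c i) ∷_) (segment≡seg x (suc (c i)) _)) (cong (seg x (c i)) (sym (+-∸-assoc 1 ci<csi)))

  IsUPFactorization⇒UP : ∀ c → IsUPFactorization x c → UPFactorization c
  IsUPFactorization⇒UP c (fact@(_ , c-inc) , u) = fact , λ i → occ i , unbordered i
    where
    occ : ∀ i → PrefixAt (c i) (c (suc i) ∸ c i)
    occ i = seg-prefix⇒PrefixAt (subst IsPrefix (block≡seg c i) (proj₂ (proj₁ (u i))))
    unbordered : ∀ i → UnborderedPrefix (c (suc i) ∸ c i)
    unbordered i = Unbordered⇒UnborderedPrefix (m<n⇒0<n∸m (c-inc i))
                     (subst Unbordered (trans (block≡seg c i) (PrefixAt⇒seg (occ i))) (proj₂ (u i)))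

  UP⇒IsUPFactorization : ∀ c → UPFactorization c → IsUPFactorization x c
  UP⇒IsUPFactorization c (fact@(_ , c-inc) , u) = fact , λ i → (nonempty i , prefix i) , unbordered i
    where
    nonempty : ∀ i → block x c i ≢ []
    nonempty i = seg-nonempty (c i) (m<n⇒0<n∸m (c-inc i)) ∘ trans (sym (block≡seg c i))
    prefix : ∀ i → IsPrefix (block x c i)
    prefix i = subst IsPrefix (sym (block≡seg c i)) (PrefixAt⇒seg-prefix (proj₁ (u i)))
    unbordered : ∀ i → Unbordered (block x c i)
    unbordered i = subst Unbordered (sym (trans (block≡seg c i) (PrefixAt⇒seg (proj₁ (u i)))))
                         (UnborderedPrefix⇒Unbordered (proj₂ (u i)))

toList-injective : {B : Set} {u v : List⁺ B} → toList u ≡ toList v → u ≡ v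
toList-injective {u = _ ∷ _} {_ ∷ _} eq = cong₂ _∷_ (∷-injectiveˡ eq) (∷-injectiveʳ eq)

module _ {B : Set} (_≟B_ : DecidableEquality B) where

  addNew-∈ : ∀ b bs → b ∈ addNew _≟B_ b bs
  addNew-∈ b []       = here refl
  addNew-∈ b (a ∷ as) with b ≟B a
  ... | yes b≡a = here b≡a
  ... | no  _   = there (addNew-∈ b as)

  addNew-⊇ : ∀ {u} b bs → u ∈ bs → u ∈ addNew _≟B_ b bs
  addNew-⊇ b (a ∷ as) u∈ with b ≟B a
  addNew-⊇ b (a ∷ as) u∈          | yes _ = u∈
  addNew-⊇ b (a ∷ as) (here u≡a)  | no  _ = here u≡a
  addNew-⊇ b (a ∷ as) (there u∈)  | no  _ = there (addNew-⊇ b as u∈)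

  All-addNew : ∀ {P : B → Set} {b bs} → All P bs → P b → All P (addNew _≟B_ b bs)
  All-addNew {b = b} {[]}     []         pb = pb ∷ []
  All-addNew {b = b} {a ∷ as} (pa ∷ pas) pb with b ≟B a
  ... | yes _ = pa ∷ pas
  ... | no  _ = pa ∷ All-addNew pas pb

  Unique-addNew : ∀ {b bs} → Unique bs → Unique (addNew _≟B_ b bs)
  Unique-addNew {b} {[]}     []               = [] ∷ []
  Unique-addNew {b} {a ∷ as} (a∉as ∷ unique) with b ≟B a
  ... | yes _   = a∉as ∷ unique
  ... | no  b≢a = All-addNew a∉as (b≢a ∘ sym) ∷ Unique-addNew unique

  indexOf-addNew : ∀ {u} b bs → u ∈ bs → indexOf _≟B_ u (addNew _≟B_ b bs) ≡ indexOf _≟B_ u bs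
  indexOf-addNew {u} b (a ∷ as) u∈ with b ≟B a
  ... | yes _ = refl
  ... | no  _ with u ≟B a | u∈
  ...   | yes _   | _          = refl
  ...   | no  u≢a | here u≡a   = ⊥-elim (u≢a u≡a)
  ...   | no  _   | there u∈′  = cong suc (indexOf-addNew b as u∈′)

  indexOf-< : ∀ {u} bs → u ∈ bs → indexOf _≟B_ u bs < length bs
  indexOf-< {u} (a ∷ as) u∈ with u ≟B a | u∈
  ... | yes _   | _         = s≤s z≤n
  ... | no  u≢a | here u≡a  = ⊥-elim (u≢a u≡a)
  ... | no  _   | there u∈′ = s≤s (indexOf-< as u∈′)

module _ {B C : Set} (_≟B_ : DecidableEquality B) (_≟C_ : DecidableEquality C)
         {f : B → C} (f-injective : ∀ {a b} → f a ≡ f b → a ≡ b) where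

  indexOf-map : ∀ b bs → indexOf _≟C_ (f b) (map f bs) ≡ indexOf _≟B_ b bs
  indexOf-map b []       = refl
  indexOf-map b (a ∷ as) with f b ≟C f a | b ≟B a
  ... | yes _      | yes _   = refl
  ... | no  _      | no  _   = cong suc (indexOf-map b as)
  ... | yes fb≡fa  | no  b≢a = ⊥-elim (b≢a (f-injective fb≡fa))
  ... | no  fb≢fa  | yes b≡a = ⊥-elim (fb≢fa (cong f b≡a))

Unique-lookup-injective : {B : Set} {bs : List B} → Unique bs → ∀ i j → lookup bs i ≡ lookup bs j → i ≡ j
Unique-lookup-injective (_ ∷ _)      zero    zero    _  = refl
Unique-lookup-injective (b∉ ∷ _)     zero    (suc j) eq = ⊥-elim (All.lookup b∉ (∈-lookup j) eq)
Unique-lookup-injective (b∉ ∷ _)     (suc i) zero    eq = ⊥-elim (All.lookup b∉ (∈-lookup i) (sym eq))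
Unique-lookup-injective (_ ∷ unique) (suc i) (suc j) eq = cong Fin.suc (Unique-lookup-injective unique i j eq)

Unique-bounded-length : ∀ {ns : List ℕ} {B} → Unique ns → All (_< B) ns → length ns ≤ B
Unique-bounded-length {ns} unique bounded = Fin.injective⇒≤ injective
  where
  bound : ∀ i → lookup ns i < _
  bound i = All.lookup bounded (∈-lookup i)
  injective : ∀ {i j} → Fin.fromℕ< (bound i) ≡ Fin.fromℕ< (bound j) → i ≡ j
  injective {i} {j} eq = Unique-lookup-injective unique i j
    (trans (sym (Fin.toℕ-fromℕ< (bound i))) (trans (cong Fin.toℕ eq) (Fin.toℕ-fromℕ< (bound j))))

listsUpTo : {B : Set} → ℕ → List B → List (List B)
listsUpTo zero    S = [] ∷ []
listsUpTo (suc n) S = [] ∷ concatMap (λ s → map (s ∷_) (listsUpTo n S)) S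

∈-listsUpTo : {B : Set} {S : List B} → ∀ n ts → length ts ≤ n → All (_∈ S) ts → ts ∈ listsUpTo n S
∈-listsUpTo zero    []       _         _          = here refl
∈-listsUpTo (suc n) []       _         _          = here refl
∈-listsUpTo (suc n) (t ∷ ts) (s≤s len≤) (t∈S ∷ ts⊆S) =
  there (∈-concatMap⁺ _ (Any.map (λ { refl → ∈-map⁺ (t ∷_) (∈-listsUpTo n ts len≤ ts⊆S) }) t∈S))

jointColouring : {T : Set} {m : ℕ} (ts : List T) → (T → Fin m) → Fin (m ^ length ts)
jointColouring []       κ = zero
jointColouring (t ∷ ts) κ = Fin.combine (κ t) (jointColouring ts κ)

jointColouring-injective : {T : Set} {m : ℕ} (ts : List T) (κ κ′ : T → Fin m) →
                           jointColouring ts κ ≡ jointColouring ts κ′ → ∀ {t} → t ∈ ts → κ t ≡ κ′ t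
jointColouring-injective (t ∷ ts) κ κ′ eq (here refl) =
  proj₁ (Fin.combine-injective (κ t) _ (κ′ t) _ eq)
jointColouring-injective (t ∷ ts) κ κ′ eq (there t∈) =
  jointColouring-injective ts κ κ′ (proj₂ (Fin.combine-injective (κ t) _ (κ′ t) _ eq)) t∈

HasMonochromaticFactorizations : {A : Set} → Word A → Set
HasMonochromaticFactorizations {A} x = ∀ (m : ℕ) (φ : List⁺ A → Fin m) → ∃ λ c → IsMonochromatic φ x c

module Monochromatic {A : Set} (_≟A_ : DecidableEquality A) (x : Word A)
                     (mono : HasMonochromaticFactorizations x) where
  open Occurrences x
  open Correspondence x

  prefixColouring : ∀ {m} → (List⁺ A → Fin m) → List⁺ A → Fin (suc m)
  prefixColouring φ w with ≡-dec _≟A_ (toList w) (pref x (length (toList w)))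
  ... | yes _ = suc (φ w)
  ... | no  _ = zero

  prefixColouring-prefix : ∀ {m} (φ : List⁺ A → Fin m) w → IsPrefix (toList w) → prefixColouring φ w ≡ suc (φ w)
  prefixColouring-prefix φ w prefix with ≡-dec _≟A_ (toList w) (pref x (length (toList w)))
  ... | yes _       = refl
  ... | no  ¬prefix = ⊥-elim (¬prefix prefix)

  prefixColouring-suc : ∀ {m} (φ : List⁺ A → Fin m) w {k} → prefixColouring φ w ≡ suc k →
                        IsPrefix (toList w) × φ w ≡ k
  prefixColouring-suc φ w eq with ≡-dec _≟A_ (toList w) (pref x (length (toList w)))
  prefixColouring-suc φ w eq | yes prefix = prefix , Fin.suc-injective eq
  prefixColouring-suc φ w () | no  _

  prefixal-monochromatic : ∀ {m} (φ : List⁺ A → Fin m) →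
                           ∃ λ c → PrefixalFactorization c × (∀ i → φ (block⁺ x c i) ≡ φ (block⁺ x c 0))
  prefixal-monochromatic φ with mono _ (prefixColouring φ)
  ... | c , fact@(c0≡0 , c-inc) , same = c , (fact , occ) , λ i → proj₂ (coloured i)
    where
    first-prefix : IsPrefix (toList (block⁺ x c 0))
    first-prefix = subst IsPrefix (sym (trans (block⁺≡seg c 0 (c-inc 0)) (cong (λ p → seg x p (c 1 ∸ c 0)) c0≡0)))
                         (PrefixAt⇒seg-prefix (λ _ _ → refl))
    coloured : ∀ i → IsPrefix (toList (block⁺ x c i)) × φ (block⁺ x c i) ≡ φ (block⁺ x c 0)
    coloured i = prefixColouring-suc φ _ (trans (same i) (prefixColouring-prefix φ _ first-prefix))
    occ : ∀ i → PrefixAt (c i) (c (suc i) ∸ c i)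
    occ i = seg-prefix⇒PrefixAt (subst IsPrefix (block⁺≡seg c i (c-inc i)) (proj₁ (coloured i)))

  UPFactorization-exists : ∃ UPFactorization
  UPFactorization-exists with prefixal-monochromatic {1} (λ _ → zero)
  ... | d , d-prefixal , _ = cut , cut-UP
    where open Refinement _≟A_ x d d-prefixal

module DerivedWord {A : Set} (_≟A_ : DecidableEquality A) (x : Word A)
                   (mono : HasMonochromaticFactorizations x) (y : Word ℕ) (derived : IsDerived _≟A_ x y) where
  open Occurrences x
  open Correspondence x
  open Monochromatic _≟A_ x mono

  c : ℕ → ℕ
  c = proj₁ derived

  c-UP : UPFactorization c
  c-UP = IsUPFactorization⇒UP c (proj₁ (proj₂ derived))

  N : ℕ
  N = c 1

  _≟L_ : DecidableEquality (List A)
  _≟L_ = ≡-dec _≟A_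

  factors : ℕ → List (List A)
  factors = distinctFactors _≟A_ x c

  table : ℕ → List ℕ
  table J = map length (factors J)

  letter : List ℕ → ℕ → ℕ
  letter T l = suc (indexOf _≟ℕ_ l T)

  block-length : ∀ n → length (block x c n) ≡ c (suc n) ∸ c n
  block-length n = trans (cong length (block≡seg c n)) (length-seg x (c n) _)

  All-factors : ∀ {P : List A → Set} → (∀ n → P (block x c n)) → ∀ J → All P (factors J)
  All-factors Pblock zero    = []
  All-factors Pblock (suc J) = All-addNew _≟L_ (All-factors Pblock J) (Pblock J)

  factors-unique : ∀ J → Unique (factors J)
  factors-unique zero    = []
  factors-unique (suc J) = Unique-addNew _≟L_ (factors-unique J)

  block-prefix : ∀ n → IsPrefix (block x c n)
  block-prefix n = proj₂ (proj₁ (proj₂ (proj₁ (proj₂ derived)) n))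

  map-pref-table : ∀ J → map (pref x) (table J) ≡ factors J
  map-pref-table J = trans (sym (map-∘ (factors J))) (map-id-local (All.map sym (All-factors block-prefix J)))

  table-bounded : ∀ J → All (_< suc N) (table J)
  table-bounded = map⁺ ∘ All-factors λ n →
    s≤s (subst (_≤ N) (sym (block-length n)) (unbordered≤first-cut c (UP⇒Prefixal c c-UP) (proj₂ (proj₂ c-UP n))))

  table-length : ∀ J → length (table J) ≤ suc N
  table-length J = Unique-bounded-length (map⁻ (subst Unique (sym (map-pref-table J)) (factors-unique J)))
                                         (table-bounded J)

  factors-grow : ∀ {u} J t → u ∈ factors J →
                 u ∈ factors (t + J) × indexOf _≟L_ u (factors (t + J)) ≡ indexOf _≟L_ u (factors J)
  factors-grow J zero    u∈ = u∈ , refl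
  factors-grow J (suc t) u∈ with factors-grow J t u∈
  ... | u∈′ , index≡ = addNew-⊇ _≟L_ _ _ u∈′ , trans (indexOf-addNew _≟L_ _ _ u∈′) index≡

  pref-injective : ∀ {a b} → pref x a ≡ pref x b → a ≡ b
  pref-injective {a} {b} eq = trans (sym (length-pref a)) (trans (cong length eq) (length-pref b))
    where
    length-pref : ∀ n → length (pref x n) ≡ n
    length-pref n = trans (cong length (pref≡seg x n)) (length-seg x 0 n)

  -- Later blocks do not change the position of a factor in the first-occurrence order.
  derivedLetter≡letter : ∀ n J → suc n ≤ J → derivedLetter _≟A_ x c n ≡ letter (table J) (length (block x c n))
  derivedLetter≡letter n J sn≤J = cong suc (begin
    indexOf _≟L_ (block x c n) (factors (suc n))
      ≡⟨ proj₂ (factors-grow (suc n) (J ∸ suc n) (addNew-∈ _≟L_ (block x c n) (factors n))) ⟨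
    indexOf _≟L_ (block x c n) (factors (J ∸ suc n + suc n))
      ≡⟨ cong (λ K → indexOf _≟L_ (block x c n) (factors K)) (m∸n+n≡m sn≤J) ⟩
    indexOf _≟L_ (block x c n) (factors J)
      ≡⟨ cong₂ (indexOf _≟L_) (block-prefix n) (sym (map-pref-table J)) ⟩
    indexOf _≟L_ (pref x (length (block x c n))) (map (pref x) (table J))
      ≡⟨ indexOf-map _≟ℕ_ _≟L_ pref-injective _ (table J) ⟩
    indexOf _≟ℕ_ (length (block x c n)) (table J) ∎)
    where open ≡-Reasoning

  finite-alphabet : FiniteAlphabet y
  finite-alphabet = upTo (suc (suc N)) , λ n →
    ∈-upTo⁺ (subst (_< suc (suc N)) (sym (proj₂ (proj₂ derived) n))
              (s≤s (<-≤-trans (indexOf-< _≟L_ (factors (suc n)) (addNew-∈ _≟L_ (block x c n) (factors n)))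
                              (subst (_≤ suc N) (length-map length (factors (suc n))) (table-length (suc n))))))

  candidates : List (List ℕ)
  candidates = listsUpTo (suc N) (upTo (suc N))

  table∈candidates : ∀ J → table J ∈ candidates
  table∈candidates J = ∈-listsUpTo (suc N) (table J) (table-length J) (All.map ∈-upTo⁺ (table-bounded J))

  -- The first clause is junk: only non-empty lists of pieces occur below.
  letters : List ℕ → List ℕ → List⁺ ℕ
  letters T []       = 0 ∷ []
  letters T (l ∷ ls) = letter T l ∷ map (letter T) ls

  letters-nonempty : ∀ T ls → 0 < length ls → toList (letters T ls) ≡ map (letter T) ls
  letters-nonempty T (_ ∷ _) _ = refl

  module Colouring (m : ℕ) (ψ : List⁺ ℕ → Fin m) where
    open Decomposition _≟A_ x using (decomposition)

    -- For every candidate table T, the colour ψ would give to the derived image of w if w were a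
    -- prefix of x whose unbordered pieces are coded by T.
    colourFor : List ℕ → List⁺ A → Fin m
    colourFor T w = ψ (letters T (decomposition (length (toList w))))

    colouring : List⁺ A → Fin (m ^ length candidates)
    colouring w = jointColouring candidates (λ T → colourFor T w)

    e : ℕ → ℕ
    e = proj₁ (prefixal-monochromatic colouring)

    e-prefixal : PrefixalFactorization e
    e-prefixal = proj₁ (proj₂ (prefixal-monochromatic colouring))

    open Refinement _≟A_ x e e-prefixal

    c≡cut : ∀ n → c n ≡ cut n
    c≡cut = UPFactorization-unique c cut c-UP cut-UP

    y-block : ∀ i J → start (suc i) ≤ J → toList (block⁺ y start i) ≡ map (letter (table J)) (pieces i)
    y-block i J end≤J =
      trans (Correspondence.block⁺≡seg y start i (proj₂ start-factorization i))
            (trans (cong (seg y (start i)) (m+n∸m≡n (start i) (len i)))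
                   (seg≡map y (letter (table J)) (start i) (pieces i) y≗))
      where
      y≗ : ∀ j → j < len i → y (start i + j) ≡ letter (table J) (nth (pieces i) j)
      y≗ j j< = begin
        y n                                           ≡⟨ proj₂ (proj₂ derived) n ⟩
        derivedLetter _≟A_ x c n                      ≡⟨ derivedLetter≡letter n J n<end ⟩
        letter (table J) (length (block x c n))       ≡⟨ cong (letter (table J)) width≡ ⟩
        letter (table J) (nth (pieces i) j)           ∎
        where
        open ≡-Reasoning
        n = start i + j
        n<end : suc n ≤ J
        n<end = ≤-trans (+-monoʳ-< (start i) j<) end≤J
        width≡ : length (block x c n) ≡ nth (pieces i) j
        width≡ = trans (block-length n) (trans (cong₂ _∸_ (c≡cut (suc n)) (c≡cut n)) (cut-width-start i j j<))

    ψ-y-block : ∀ i J → start (suc i) ≤ J → ψ (block⁺ y start i) ≡ colourFor (table J) (block⁺ x e i)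
    ψ-y-block i J end≤J = cong ψ (toList-injective (begin
      toList (block⁺ y start i)
        ≡⟨ y-block i J end≤J ⟩
      map (letter (table J)) (pieces i)
        ≡⟨ letters-nonempty (table J) (pieces i) (pieces-nonempty i) ⟨
      toList (letters (table J) (pieces i))
        ≡⟨ cong (λ ℓ → toList (letters (table J) (decomposition ℓ))) width≡ ⟨
      toList (letters (table J) (decomposition (length (toList (block⁺ x e i))))) ∎))
      where
      open ≡-Reasoning
      width≡ : length (toList (block⁺ x e i)) ≡ width i
      width≡ = trans (cong length (block⁺≡seg e i (proj₂ (proj₁ e-prefixal) i))) (length-seg x (e i) _)

    y-monochromatic : ∀ i → ψ (block⁺ y start i) ≡ ψ (block⁺ y start 0)
    y-monochromatic i = begin
      ψ (block⁺ y start i)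
        ≡⟨ ψ-y-block i J (m≤m+n _ _) ⟩
      colourFor (table J) (block⁺ x e i)
        ≡⟨ jointColouring-injective candidates (λ T → colourFor T (block⁺ x e i)) (λ T → colourFor T (block⁺ x e 0))
                                    (same i) (table∈candidates J) ⟩
      colourFor (table J) (block⁺ x e 0)
        ≡⟨ ψ-y-block 0 J (m≤n+m _ _) ⟨
      ψ (block⁺ y start 0) ∎
      where
      open ≡-Reasoning
      J = start (suc i) + start 1
      same : ∀ i → colouring (block⁺ x e i) ≡ colouring (block⁺ x e 0)
      same = proj₂ (proj₂ (prefixal-monochromatic colouring))

    y-monochromatic-factorization : ∃ λ a → IsMonochromatic ψ y a
    y-monochromatic-factorization = start , start-factorization , y-monochromatic

  has-monochromatic : HasMonochromaticFactorizations y
  has-monochromatic m ψ = Colouring.y-monochromatic-factorization m ψ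

module _ {A : Set} (_≟A_ : DecidableEquality A) {x : Word A} (mono : HasMonochromaticFactorizations x) where
  open Monochromatic _≟A_ x mono using (UPFactorization-exists)


  monochromatic⇒P₁ : FiniteAlphabet x → P₁ x
  monochromatic⇒P₁ finite = finite , c , proj₁ c-IsUP , λ i → proj₁ (proj₂ c-IsUP i)
    where
    c = proj₁ UPFactorization-exists
    c-IsUP = Correspondence.UP⇒IsUPFactorization x c (proj₂ UPFactorization-exists)

  derived-exists : ∃ (IsDerived _≟A_ x)
  derived-exists =
    derivedLetter _≟A_ x c , c , Correspondence.UP⇒IsUPFactorization x c (proj₂ UPFactorization-exists) , λ _ → refl
    where
    c = proj₁ UPFactorization-exists

  derived-monochromatic : ∀ {y} → IsDerived _≟A_ x y → HasMonochromaticFactorizations y × FiniteAlphabet y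
  derived-monochromatic {y} derived = has-monochromatic , finite-alphabet
    where open DerivedWord _≟A_ x mono y derived

iterate-monochromatic : {A : Set} (_≟A_ : DecidableEquality A) {x : Word A} → HasMonochromaticFactorizations x →
                        ∀ n {y} → IsDerivedIter _≟A_ n x y → HasMonochromaticFactorizations y × FiniteAlphabet y
iterate-monochromatic _≟A_ mono zero    derived                   = derived-monochromatic _≟A_ mono derived
iterate-monochromatic _≟A_ mono (suc n) (y , y-iter , z-derived) =
  derived-monochromatic _≟ℕ_ (proj₁ (iterate-monochromatic _≟A_ mono n y-iter)) z-derived

iterate-exists : {A : Set} (_≟A_ : DecidableEquality A) {x : Word A} → HasMonochromaticFactorizations x →
                 ∀ n → ∃ (IsDerivedIter _≟A_ n x)
iterate-exists _≟A_ mono zero    = derived-exists _≟A_ mono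
iterate-exists _≟A_ mono (suc n) = z , y , y-iter , z-derived
  where
  y = proj₁ (iterate-exists _≟A_ mono n)
  y-iter = proj₂ (iterate-exists _≟A_ mono n)
  z = proj₁ (derived-exists _≟ℕ_ (proj₁ (iterate-monochromatic _≟A_ mono n y-iter)))
  z-derived = proj₂ (derived-exists _≟ℕ_ (proj₁ (iterate-monochromatic _≟A_ mono n y-iter)))

monochromatic⇒P∞ : {A : Set} (_≟A_ : DecidableEquality A) {x : Word A} → HasMonochromaticFactorizations x →
                   FiniteAlphabet x → P∞ _≟A_ x
monochromatic⇒P∞ _≟A_ mono finite = monochromatic⇒P₁ _≟A_ mono finite , λ n →
  (let y , y-iter = iterate-exists _≟A_ mono n in y , y-iter , iterate-P₁ n y-iter) , λ _ → iterate-P₁ n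
  where
  iterate-P₁ : ∀ n {y} → IsDerivedIter _≟A_ n _ y → P₁ y
  iterate-P₁ n y-iter = let y-mono , y-finite = iterate-monochromatic _≟A_ mono n y-iter
                        in monochromatic⇒P₁ _≟ℕ_ y-mono y-finite

mainTheorem1 : (k : ℕ) (x : Word (Fin k)) → BigP x → P∞ _≟_ x
mainTheorem1 k x mono = monochromatic⇒P∞ _≟_ mono (allFin k , λ i → ∈-allFin (x i))
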